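{- Let $\mathsf{III}$ (call-by-name), $\mathsf{IIS}$, $\mathsf{SII}$ (head spine) and $\mathsf{SIS}$ be the uniform evaluators described in the context. Then $\mathsf{SIS}$ absorbs none of $\mathsf{III}$, $\mathsf{IIS}$, $\mathsf{SII}$: $\mathsf{SIS}\circ\mathsf{III}\neq\mathsf{SIS}$, $\mathsf{SIS}\circ\mathsf{IIS}\neq\mathsf{SIS}$ and $\mathsf{SIS}\circ\mathsf{SII}\neq\mathsf{SIS}$ as partial functions on $\lambda$-terms.
   Context: Terms: $\Lambda ::= x\mid \lambda x.\Lambda\mid \Lambda\Lambda$ (modulo $\alpha$); $[N/x]B$ is capture-avoiding substitution. An evaluator is a partial function $\Lambda\rightharpoonup\Lambda$ (undefined = divergence); $\mathrm{id}$ is the identity; $(E_2\circ E_1)(M)=E_2(E_1(M))$, undefined if $E_1(M)$ is undefined. $E_2$ absorbs $E_1$ iff $E_2\circ E_1=E_2$. Eval-apply template: $E$ is the least partial function with $E(x)=x$; $E(\lambda x.B)=\lambda x.\mathit{la}(B)$; for $E(MN)$: compute $M'=\mathit{op}_1(M)$; if $M'\equiv\lambda x.B$, compute $N'=\mathit{ar}_1(N)$ and return $E([N'/x]B)$; otherwise compute $M''=\mathit{op}_2(M')$, then $N'=\mathit{ar}_2(N)$, and return $M''N'$ (in this order; divergence propagates). For a triple $XYZ$ with $X,Y,Z\in\{\mathsf I,\mathsf S\}$, the uniform evaluator $XYZ$ is the instance with $\mathit{op}_1=E$, $\mathit{op}_2=\mathrm{id}$, and $\mathit{la},\mathit{ar}_1,\mathit{ar}_2$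 given respectively by $X,Y,Z$, where $\mathsf I$ means $\mathrm{id}$ and $\mathsf S$ means $E$ itself. -}

module Defs where

open import Data.Nat using (ℕ; zero; suc; _+_; _<ᵇ_; compare; less; equal; greater)
open import Data.Bool using (if_then_else_)
open import Data.Product using (Σ; _×_)

-- λ-terms modulo α, as de Bruijn terms (free variables = indices beyond the binders).
data Term : Set where
  var : ℕ → Term
  lam : Term → Term
  app : Term → Term → Term

shift : ℕ → Term → Term
shift c (var k)   = if k <ᵇ c then var k else var (suc k)
shift c (lam t)   = lam (shift (suc c) t)
shift c (app t u) = app (shift c t) (shift c u)

-- substitute s for index j, lowering the free indices above j (the binder is removed)
substVar : ℕ → Term → ℕ → Term
substVar j s k with compare k j
... | less _ _    = var k
... | equal _     = s
... | greater _ m = var (j + m)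

subst : ℕ → Term → Term → Term
subst j s (var k)   = substVar j s k
subst j s (lam t)   = lam (subst (suc j) (shift 0 s) t)
subst j s (app t u) = app (subst j s t) (subst j s u)

-- [N/x]B where B is the body of λx.B
_[_] : Term → Term → Term
B [ N ] = subst 0 N B

-- I = identity, S = the evaluator itself
data Mode : Set where
  I S : Mode

-- a uniform evaluator XYZ : la = X, ar₁ = Y, ar₂ = Z  (op₁ = E, op₂ = id)
record Uniform : Set where
  constructor uni
  field
    la ar₁ ar₂ : Mode
open Uniform public

III IIS SII SIS : Uniform
III = uni I I I
IIS = uni I I S
SII = uni S I I
SIS = uni S I S

data NotLam : Term → Set where
  nl-var : ∀ {k} → NotLam (var k)
  nl-app : ∀ {t u} → NotLam (app t u)

-- Graph of the least partial function E given by the eval-apply template.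
-- u ⊢ M ⇓ N  means  E(M) is defined and equals N.
-- u ⊢ M ⇒[ m ] N  means  (id or E, according to m)(M) = N.
mutual
  data _⊢_⇓_ (u : Uniform) : Term → Term → Set where
    ev-var : ∀ {k} → u ⊢ var k ⇓ var k
    ev-lam : ∀ {B B'} → u ⊢ B ⇒[ la u ] B' → u ⊢ lam B ⇓ lam B'
    ev-β   : ∀ {M N B N' R} → u ⊢ M ⇓ lam B → u ⊢ N ⇒[ ar₁ u ] N' →
             u ⊢ B [ N' ] ⇓ R → u ⊢ app M N ⇓ R
    ev-app : ∀ {M N M' N'} → u ⊢ M ⇓ M' → NotLam M' → u ⊢ N ⇒[ ar₂ u ] N' →
             u ⊢ app M N ⇓ app M' N'

  data _⊢_⇒[_]_ (u : Uniform) : Term → Mode → Term → Set where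
    by-id : ∀ {M} → u ⊢ M ⇒[ I ] M
    by-E  : ∀ {M N} → u ⊢ M ⇓ N → u ⊢ M ⇒[ S ] N

_∘ᴱ_ : Uniform → Uniform → Term → Term → Set
(e₂ ∘ᴱ e₁) M R = Σ Term (λ M' → (e₁ ⊢ M ⇓ M') × (e₂ ⊢ M' ⇓ R))

Absorbs : Uniform → Uniform → Set
Absorbs e₂ e₁ = ∀ M R → ((e₂ ∘ᴱ e₁) M R → e₂ ⊢ M ⇓ R) × (e₂ ⊢ M ⇓ R → (e₂ ∘ᴱ e₁) M R)

-- Take T = (λx. x Ω) (λx.λy.y). If arguments of redexes are passed unevaluated
-- (ar₁ = I) and moreover either bodies of abstractions (la = I) or arguments of stuck
-- applications (ar₂ = I) are left alone, Ω is never evaluated and T ⇓ λy.y, which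
-- SIS fixes. SIS itself diverges on T: evaluating the operator means evaluating its
-- body x Ω, a stuck application whose argument Ω it then evaluates.
module Submission where

open import Defs
open import Data.Product using (_×_; _,_; proj₁)
open import Relation.Nullary using (¬_)
open import Relation.Binary.PropositionalEquality using (_≡_; refl)

_⊢_⇑ : Uniform → Term → Set
u ⊢ M ⇑ = ∀ {R} → ¬ (u ⊢ M ⇓ R)

¬absorbs-of-divergence : ∀ {e₁ e₂ M N R} →
  e₁ ⊢ M ⇓ N → e₂ ⊢ N ⇓ R → e₂ ⊢ M ⇑ → ¬ Absorbs e₂ e₁
¬absorbs-of-divergence {M = M} {N} {R} M⇓N N⇓R M⇑ absorbs =
  M⇑ (proj₁ (absorbs M R) (N , M⇓N , N⇓R))

app-⇑ : ∀ {u M N} → u ⊢ M ⇑ → u ⊢ app M N ⇑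
app-⇑ M⇑ (ev-β M⇓ _ _)   = M⇑ M⇓
app-⇑ M⇑ (ev-app M⇓ _ _) = M⇑ M⇓

var-⇒ : ∀ {u k} m → u ⊢ var k ⇒[ m ] var k
var-⇒ I = by-id
var-⇒ S = by-E ev-var

lam-var-⇓ : ∀ {u k} → u ⊢ lam (var k) ⇓ lam (var k)
lam-var-⇓ {u} = ev-lam (var-⇒ (la u))

ω Ω : Term
ω = lam (app (var 0) (var 0))
Ω = app ω ω

var0·var0-⇒ : ∀ {u m B} → u ⊢ app (var 0) (var 0) ⇒[ m ] B → B ≡ app (var 0) (var 0)
var0·var0-⇒ by-id                                       = refl
var0·var0-⇒ (by-E (ev-β () _ _))
var0·var0-⇒ (by-E (ev-app ev-var nl-var by-id))         = refl
var0·var0-⇒ (by-E (ev-app ev-var nl-var (by-E ev-var))) = refl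

ω-⇓ : ∀ {u R} → u ⊢ ω ⇓ R → R ≡ ω
ω-⇓ (ev-lam body) with refl ← var0·var0-⇒ body = refl

ω-⇒ : ∀ {u m R} → u ⊢ ω ⇒[ m ] R → R ≡ ω
ω-⇒ by-id      = refl
ω-⇒ (by-E ω⇓) = ω-⇓ ω⇓

Ω-⇑ : ∀ {u} → u ⊢ Ω ⇑
Ω-⇑ (ev-β (ev-lam body) arg Ω⇓)
  with refl ← var0·var0-⇒ body | refl ← ω-⇒ arg = Ω-⇑ Ω⇓
Ω-⇑ (ev-app (ev-lam _) () _)

applyToΩ KI : Term
applyToΩ = lam (app (var 0) Ω)
KI       = lam (lam (var 0))

applyToΩ-⇑ : ∀ {y} → uni S y S ⊢ applyToΩ ⇑
applyToΩ-⇑ (ev-lam (by-E (ev-β () _ _)))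
applyToΩ-⇑ (ev-lam (by-E (ev-app ev-var nl-var (by-E Ω⇓)))) = Ω-⇑ Ω⇓

lazy-applyToΩ·KI-⇓ : ∀ {z} → uni I I z ⊢ app applyToΩ KI ⇓ lam (var 0)
lazy-applyToΩ·KI-⇓ = ev-β (ev-lam by-id) by-id (ev-β (ev-lam by-id) by-id (ev-lam by-id))

headSpine-applyToΩ·KI-⇓ : SII ⊢ app applyToΩ KI ⇓ lam (var 0)
headSpine-applyToΩ·KI-⇓ =
  ev-β (ev-lam (by-E (ev-app ev-var nl-var by-id))) by-id
       (ev-β (ev-lam (by-E lam-var-⇓)) by-id lam-var-⇓)

proposition7p8 : ¬ Absorbs SIS III × ¬ Absorbs SIS IIS × ¬ Absorbs SIS SII
proposition7p8 = separated-by lazy-applyToΩ·KI-⇓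
               , separated-by lazy-applyToΩ·KI-⇓
               , separated-by headSpine-applyToΩ·KI-⇓
  where
  separated-by : ∀ {u} → u ⊢ app applyToΩ KI ⇓ lam (var 0) → ¬ Absorbs SIS u
  separated-by T⇓ = ¬absorbs-of-divergence T⇓ lam-var-⇓ (app-⇑ applyToΩ-⇑)
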